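{- Let $s,k$ be positive integers. The nice order ideals of $P(s,k)$ are in one-to-one correspondence with the order ideals of $P'(s,k)$ that do not contain two elements $(a,0)$ and $(a',-1)$ with $|a-a'|\le k/2$.
   Context: Define $L(s,k)=\bigcup_{j\ge0}\{2i-1+2sj : i\in\mathbb{Z},\ jk+1\le i\le\lfloor s/2\rfloor\}$, $R(s,k)=\bigcup_{j\ge0}\{2i-1+2sj : i\in\mathbb{Z},\ jk+\lceil(s+k)/2\rceil+1\le i\le s\}$, and $P(s,k)=L(s,k)\cup R(s,k)$ with the partial order generated by: $y$ covers $x$ iff $y=x+2s+2t$ for some integer $0\le t\le k$. An order ideal $I$ of $P(s,k)$ (a downward closed subset) is nice if there are no $h_1,h_2\in I$ with $h_1+h_2\in\{2s,2s+2,\ldots,2s+2k\}$. Define $L'(s,k)=\bigcup_{j\ge0}\{(i-\tfrac{k}{2}j,\ j): i\in\mathbb{Z},\ jk+1\le i\le\lfloor s/2\rfloor\}$ and $R'(s,k)=\bigcup_{j\ge0}\{(s+1-i+\tfrac{k}{2}(j+1),\ -j-1): i\in\mathbb{Z},\ jk+\lceil(s+k)/2\rceil+1\le i\le s\}$, and $P'(s,k)=L'(s,k)\cup R'(s,k)$ with the partial order generated by the cover relations: for $(a,b),(a',b')\in L'(s,k)$, $(a,b)$ covers $(a',b')$ iff $|a-a'|\le k/2$ and $b=b'+1$; for $(a,b),(a',b')\in R'(s,k)$, $(a,b)$ covers $(a',b')$ iff $|a-a'|\le k/2$ and $b=b'-1$ (no element of $L'$ is comparable to an element of $R'$). -}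

module Defs where

open import Level using (0ℓ)
open import Data.Bool using (Bool; true; false)
open import Data.Nat using (ℕ; zero; suc; _+_; _*_; _∸_; _≤_; ⌊_/2⌋; ⌈_/2⌉)
open import Data.Integer as ℤ using (ℤ; +_; -[1+_]; ∣_∣)
open import Data.Product using (Σ; ∃; ∃-syntax; _×_; _,_; proj₁)
open import Relation.Nullary using (¬_)
open import Relation.Binary.PropositionalEquality using (_≡_; _≢_; refl; sym; trans)
open import Relation.Binary.Bundles using (Setoid)
open import Relation.Binary.Construct.Closure.ReflexiveTransitive using (Star)

InL : ℕ → ℕ → ℕ → Set
InL s k n = ∃[ j ] ∃[ i ] (j * k + 1 ≤ i × i ≤ ⌊ s /2⌋ × n ≡ 2 * i ∸ 1 + 2 * s * j)

InR : ℕ → ℕ → ℕ → Set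
InR s k n = ∃[ j ] ∃[ i ] (j * k + ⌈ s + k /2⌉ + 1 ≤ i × i ≤ s × n ≡ 2 * i ∸ 1 + 2 * s * j)

InP : ℕ → ℕ → ℕ → Set
InP s k n = InL s k n Data.Sum.⊎ InR s k n
  where import Data.Sum

CoverP : ℕ → ℕ → ℕ → ℕ → Set
CoverP s k x y = InP s k x × InP s k y × ∃[ t ] (t ≤ k × y ≡ x + 2 * s + 2 * t)

LeqP : ℕ → ℕ → ℕ → ℕ → Set
LeqP s k = Star (CoverP s k)

IsIdealP : ℕ → ℕ → (ℕ → Bool) → Set
IsIdealP s k I =
  (∀ n → I n ≡ true → InP s k n) ×
  (∀ x y → InP s k x → LeqP s k x y → I y ≡ true → I x ≡ true)

IsNice : ℕ → ℕ → (ℕ → Bool) → Set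
IsNice s k I = ∀ h₁ h₂ → I h₁ ≡ true → I h₂ ≡ true →
  ∀ t → t ≤ k → h₁ + h₂ ≢ 2 * s + 2 * t

NiceIdealSetoid : ℕ → ℕ → Setoid 0ℓ 0ℓ
NiceIdealSetoid s k = record
  { Carrier = Σ (ℕ → Bool) (λ I → IsIdealP s k I × IsNice s k I)
  ; _≈_ = λ I J → ∀ n → proj₁ I n ≡ proj₁ J n
  ; isEquivalence = record
    { refl = λ n → refl
    ; sym = λ p n → sym (p n)
    ; trans = λ p q n → trans (p n) (q n) } }

-- The poset P'(s,k) ⊆ (½ℤ) × ℤ, encoded with DOUBLED first coordinate:
-- the point (a , b) of the paper is represented as (2a , b) ∈ ℤ × ℤ.

Pt : Set
Pt = ℤ × ℤ

-- (2(i - k j/2), j) = (2i - k j, j)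
InL' : ℕ → ℕ → Pt → Set
InL' s k p = ∃[ j ] ∃[ i ] (j * k + 1 ≤ i × i ≤ ⌊ s /2⌋ ×
  p ≡ ((+ (2 * i)) ℤ.- (+ (k * j)) , + j))

-- (2(s+1-i) + k(j+1), -j-1)   (note i ≤ s, so s+1-i ≥ 1)
InR' : ℕ → ℕ → Pt → Set
InR' s k p = ∃[ j ] ∃[ i ] (j * k + ⌈ s + k /2⌉ + 1 ≤ i × i ≤ s ×
  p ≡ (+ (2 * (s + 1 ∸ i) + k * (j + 1)) , -[1+ j ]))

InP' : ℕ → ℕ → Pt → Set
InP' s k p = InL' s k p Data.Sum.⊎ InR' s k p
  where import Data.Sum

-- CoverP' s k q p : "p covers q"   (|a - a'| ≤ k/2  ⇔  |2a - 2a'| ≤ k)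
CoverP' : ℕ → ℕ → Pt → Pt → Set
CoverP' s k (a' , b') (a , b) =
  (InL' s k (a , b) × InL' s k (a' , b') × ∣ a ℤ.- a' ∣ ≤ k × b ≡ b' ℤ.+ + 1)
  Data.Sum.⊎
  (InR' s k (a , b) × InR' s k (a' , b') × ∣ a ℤ.- a' ∣ ≤ k × b ≡ b' ℤ.- + 1)
  where import Data.Sum

LeqP' : ℕ → ℕ → Pt → Pt → Set
LeqP' s k = Star (CoverP' s k)

IsIdealP' : ℕ → ℕ → (Pt → Bool) → Set
IsIdealP' s k I =
  (∀ p → I p ≡ true → InP' s k p) ×
  (∀ p q → InP' s k p → LeqP' s k p q → I q ≡ true → I p ≡ true)

NoClash : ℕ → (Pt → Bool) → Set
NoClash k I = ∀ a a' → I (a , + 0) ≡ true → I (a' , -[1+ 0 ]) ≡ true →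
  ¬ (∣ a ℤ.- a' ∣ ≤ k)

GoodIdealSetoid' : ℕ → ℕ → Setoid 0ℓ 0ℓ
GoodIdealSetoid' s k = record
  { Carrier = Σ (Pt → Bool) (λ I → IsIdealP' s k I × NoClash k I)
  ; _≈_ = λ I J → ∀ p → proj₁ I p ≡ proj₁ J p
  ; isEquivalence = record
    { refl = λ p → refl
    ; sym = λ e p → sym (e p)
    ; trans = λ e f p → trans (e p) (f p) } }

module Submission where

-- Both posets are images of one index set: a valid index (σ, j, i) (side, level,
-- position) gives the label 2i - 1 + 2sj of P and the point (i - kj/2, j) or
-- (s+1-i + k(j+1)/2, -j-1) of P'.  We show that
--   * both maps are injective on valid indices and exhaust their posets;
--   * the covers of P and of P' both coincide with the index relation Step
--     (same side, next level, position shifted by t ≤ k), so the orders agree;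
--   * two labels sum into {2s, …, 2s+2k} exactly when their points clash.

open import Defs
open import Level using (0ℓ)
open import Data.Bool using (Bool; true; false)
open import Data.Nat using (ℕ; zero; suc; _+_; _*_; _∸_; _≤_; _<_; z≤n; s≤s; ⌊_/2⌋; ⌈_/2⌉; _≤?_; _≟_)
open import Data.Nat.Properties
open import Data.Integer as ℤ using (ℤ; +_; -[1+_]; ∣_∣; _⊖_)
import Data.Integer.Properties as ℤP
import Data.Integer.Tactic.RingSolver as ℤSolver
open import Data.Nat.Tactic.RingSolver using (solve-∀)
open import Data.Product using (Σ; ∃; _×_; _,_; proj₁; proj₂)
import Data.Product.Properties as ×P
import Data.Bool.Properties as Boolᴾ
open import Data.Sum using (_⊎_; inj₁; inj₂)
open import Data.Empty using (⊥; ⊥-elim)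
open import Function.Bundles using (Bijection)
open import Relation.Nullary using (¬_; Dec; yes; no; does)
open import Relation.Nullary.Decidable using (map′; _×-dec_; _⊎-dec_; dec-true)
open import Relation.Binary.Bundles using (Setoid)
open import Relation.Binary.Definitions using (tri<; tri≈; tri>)
open import Relation.Binary.PropositionalEquality
open import Relation.Binary.Construct.Closure.ReflexiveTransitive using (Star; ε; _◅_)

SubsetSetoid : (A : Set) → ((A → Bool) → Set) → Setoid 0ℓ 0ℓ
SubsetSetoid A Good = record
  { Carrier = Σ (A → Bool) Good
  ; _≈_ = λ I J → ∀ a → proj₁ I a ≡ proj₁ J a
  ; isEquivalence = record
    { refl = λ a → refl
    ; sym = λ p a → sym (p a)
    ; trans = λ p q a → trans (p a) (q a) } }

true⇔true⇒≡ : ∀ {a b : Bool} → (a ≡ true → b ≡ true) → (b ≡ true → a ≡ true) → a ≡ b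
true⇔true⇒≡ {false} {false} _ _ = refl
true⇔true⇒≡ {false} {true}  _ g = g refl
true⇔true⇒≡ {true}          f _ = sym (f refl)

does⇒witness : ∀ {P : Set} (d : Dec P) → does d ≡ true → P
does⇒witness (yes p) _ = p
does⇒witness (no _) ()

module SubsetTransport
  {X A B : Set} (Valid : X → Set) (f : X → A) (g : X → B)
  (f-injective : ∀ {x y} → Valid x → Valid y → f x ≡ f y → x ≡ y)
  (g-injective : ∀ {x y} → Valid x → Valid y → g x ≡ g y → x ≡ y)
  (push? : ∀ (I : A → Bool) b → Dec (∃ λ x → Valid x × b ≡ g x × I (f x) ≡ true))
  (pull? : ∀ (J : B → Bool) a → Dec (∃ λ x → Valid x × a ≡ f x × J (g x) ≡ true))
  where

  push : (A → Bool) → B → Bool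
  push I b = does (push? I b)

  pull : (B → Bool) → A → Bool
  pull J a = does (pull? J a)

  push-sound : ∀ I b → push I b ≡ true → ∃ λ x → Valid x × b ≡ g x × I (f x) ≡ true
  push-sound I b = does⇒witness (push? I b)

  push-complete : ∀ I x → Valid x → I (f x) ≡ true → push I (g x) ≡ true
  push-complete I x v Ix = dec-true (push? I (g x)) (x , v , refl , Ix)

  pull-sound : ∀ J a → pull J a ≡ true → ∃ λ x → Valid x × a ≡ f x × J (g x) ≡ true
  pull-sound J a = does⇒witness (pull? J a)

  pull-complete : ∀ J x → Valid x → J (g x) ≡ true → pull J (f x) ≡ true
  pull-complete J x v Jx = dec-true (pull? J (f x)) (x , v , refl , Jx)

  module _
    (Good₁ : (A → Bool) → Set) (Good₂ : (B → Bool) → Set)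
    (support₁ : ∀ {I} → Good₁ I → ∀ a → I a ≡ true → ∃ λ x → Valid x × a ≡ f x)
    (support₂ : ∀ {J} → Good₂ J → ∀ b → J b ≡ true → ∃ λ x → Valid x × b ≡ g x)
    (push-good : ∀ I → Good₁ I → Good₂ (push I))
    (pull-good : ∀ J → Good₂ J → Good₁ (pull J))
    where

    private
      push-mono : ∀ I I' → (∀ a → I a ≡ true → I' a ≡ true) → ∀ b → push I b ≡ true → push I' b ≡ true
      push-mono I I' I⊆I' b e with push-sound I b e
      ... | x , v , refl , Ix = push-complete I' x v (I⊆I' (f x) Ix)

      -- push reflects inclusion of good subsets, since g is injective on valid indices
      push-reflects : ∀ I I' → Good₁ I → (∀ b → push I b ≡ push I' b) → ∀ a → I a ≡ true → I' a ≡ true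
      push-reflects I I' good eq a Ia with support₁ good a Ia
      ... | x , v , refl with push-sound I' (g x) (trans (sym (eq (g x))) (push-complete I x v Ia))
      ... | y , w , gx≡gy , I'y with g-injective v w gx≡gy
      ... | refl = I'y

      -- push ∘ pull is the identity on good subsets of B (f injective on valid indices)
      push-pull : ∀ J → Good₂ J → ∀ (Z : A → Bool) → (∀ a → Z a ≡ pull J a) → ∀ b → push Z b ≡ J b
      push-pull J good Z eq b = true⇔true⇒≡ to from
        where
        to : push Z b ≡ true → J b ≡ true
        to e with push-sound Z b e
        ... | x , v , refl , Zx with pull-sound J (f x) (trans (sym (eq (f x))) Zx)
        ... | y , w , fx≡fy , Jy with f-injective v w fx≡fy
        ... | refl = Jy
        from : J b ≡ true → push Z b ≡ true
        from Jb with support₂ good b Jb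
        ... | x , v , refl = push-complete Z x v (trans (eq (f x)) (pull-complete J x v Jb))

    bijection : Bijection (SubsetSetoid A Good₁) (SubsetSetoid B Good₂)
    bijection = record
      { to = λ { (I , good) → push I , push-good I good }
      ; cong = λ {(I , _)} {(I' , _)} eq b →
          true⇔true⇒≡ (push-mono I I' (λ a e → trans (sym (eq a)) e) b)
                      (push-mono I' I (λ a e → trans (eq a) e) b)
      ; bijective =
          (λ {(I , good)} {(I' , good')} eq a →
            true⇔true⇒≡ (push-reflects I I' good eq a) (push-reflects I' I good' (λ b → sym (eq b)) a))
        , λ { (J , good) → (pull J , pull-good J good) , λ {(Z , _)} eq → push-pull J good Z eq }
      }

module _ {X A B : Set} {R : A → A → Set} {S : B → B → Set}
  (Valid : X → Set) (f : X → A) (g : X → B)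
  (f-injective : ∀ {x y} → Valid x → Valid y → f x ≡ f y → x ≡ y)
  (target : ∀ {a b} → R a b → ∃ λ y → Valid y × b ≡ f y)
  (step : ∀ {x y} → Valid x → Valid y → R (f x) (f y) → S (g x) (g y))
  where

  starMap : ∀ {a b} → Star R a b → ∀ {x y} → Valid x → a ≡ f x → Valid y → b ≡ f y →
    Star S (g x) (g y)
  starMap ε v a≡fx w a≡fy with f-injective v w (trans (sym a≡fx) a≡fy)
  ... | refl = ε
  starMap (r ◅ rs) v refl w b≡fy with target r
  ... | z , u , refl = step v u r ◅ starMap rs u refl w b≡fy

-- The elements of both posets are indexed by a side (the L-part or the R-part),
-- a level j and a position i.
data Side : Set where
  left right : Side

Index : Set
Index = Side × ℕ × ℕ

searchIndex : {Q : Index → Set} → (∀ x → Dec (Q x)) → (B C : ℕ) →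
  (∀ {σ j i} → Q (σ , j , i) → j ≤ B × i ≤ C) → Dec (∃ Q)
searchIndex {Q} Q? B C boxed = map′ found locate
  (anyUpTo? (λ j → anyUpTo? (λ i → Q? (left , j , i) ⊎-dec Q? (right , j , i)) (suc C)) (suc B))
  where
  InBox : Set
  InBox = ∃ λ j → j < suc B × ∃ λ i → i < suc C × (Q (left , j , i) ⊎ Q (right , j , i))
  found : InBox → ∃ Q
  found (_ , _ , _ , _ , inj₁ q) = _ , q
  found (_ , _ , _ , _ , inj₂ q) = _ , q
  locate : ∃ Q → InBox
  locate ((left , j , i) , q) = j , s≤s (proj₁ (boxed q)) , i , s≤s (proj₂ (boxed q)) , inj₁ q
  locate ((right , j , i) , q) = j , s≤s (proj₁ (boxed q)) , i , s≤s (proj₂ (boxed q)) , inj₂ q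

Within : ℕ → ℕ → ℕ → Set
Within k x y = ∃ λ t → t ≤ k × y ≡ x + t

∣⊖∣≤⇒bounds : ∀ x y k → ∣ x ⊖ y ∣ ≤ k → y ≤ x + k × x ≤ y + k
∣⊖∣≤⇒bounds zero y k h = subst (_≤ k) (ℤP.∣⊖∣-≤ {0} {y} z≤n) h , z≤n
∣⊖∣≤⇒bounds (suc x) zero k h = z≤n , subst (_≤ k) (cong ∣_∣ (ℤP.⊖-≥ {suc x} {0} z≤n)) h
∣⊖∣≤⇒bounds (suc x) (suc y) k h
  with ∣⊖∣≤⇒bounds x y k (subst (λ z → ∣ z ∣ ≤ k) (ℤP.[1+m]⊖[1+n]≡m⊖n x y) h)
... | y≤x+k , x≤y+k = s≤s y≤x+k , s≤s x≤y+k

bounds⇒∣⊖∣≤ : ∀ x y k → y ≤ x + k → x ≤ y + k → ∣ x ⊖ y ∣ ≤ k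
bounds⇒∣⊖∣≤ zero y k y≤k _ = subst (_≤ k) (sym (ℤP.∣⊖∣-≤ {0} {y} z≤n)) y≤k
bounds⇒∣⊖∣≤ (suc x) zero k _ x≤k = subst (_≤ k) (sym (cong ∣_∣ (ℤP.⊖-≥ {suc x} {0} z≤n))) x≤k
bounds⇒∣⊖∣≤ (suc x) (suc y) k (s≤s y≤x+k) (s≤s x≤y+k) =
  subst (λ z → ∣ z ∣ ≤ k) (sym (ℤP.[1+m]⊖[1+n]≡m⊖n x y)) (bounds⇒∣⊖∣≤ x y k y≤x+k x≤y+k)

-- The key metric fact behind both cover relations and the clash condition of P':
-- the doubled coordinate 2y lies within k of  2x + k  exactly when y ∈ [x, x + k].
close⇒within : ∀ x y k → ∣ 2 * y ⊖ (2 * x + k) ∣ ≤ k → Within k x y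
close⇒within x y k h = y ∸ x , m≤n+o⇒m∸n≤o y x y≤x+k , sym (m+[n∸m]≡n x≤y)
  where
  bounds : 2 * x + k ≤ 2 * y + k × 2 * y ≤ 2 * x + k + k
  bounds = ∣⊖∣≤⇒bounds (2 * y) (2 * x + k) k h
  x≤y : x ≤ y
  x≤y = *-cancelˡ-≤ 2 (+-cancelʳ-≤ k _ _ (proj₁ bounds))
  y≤x+k : y ≤ x + k
  y≤x+k = *-cancelˡ-≤ 2 (subst (2 * y ≤_) (regroup x k) (proj₂ bounds))
    where
    regroup : ∀ x k → 2 * x + k + k ≡ 2 * (x + k)
    regroup = solve-∀

within⇒close : ∀ x y k → Within k x y → ∣ 2 * y ⊖ (2 * x + k) ∣ ≤ k
within⇒close x .(x + t) k (t , t≤k , refl) = bounds⇒∣⊖∣≤ (2 * (x + t)) (2 * x + k) k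
  (+-monoˡ-≤ k (*-monoʳ-≤ 2 (m≤m+n x t)))
  (subst (_≤ 2 * x + k + k) (sym (*-distribˡ-+ 2 x t))
    (subst (2 * x + 2 * t ≤_) (sym (+-assoc (2 * x) k k)) (+-monoʳ-≤ (2 * x) (2t≤k+k))))
  where
  2t≤k+k : 2 * t ≤ k + k
  2t≤k+k = +-mono-≤ t≤k (subst (_≤ k) (sym (+-identityʳ t)) t≤k)

ℤ-sub-cancelʳ : ∀ {x y : ℤ} c → x ℤ.- c ≡ y ℤ.- c → x ≡ y
ℤ-sub-cancelʳ {x} {y} c e = trans (sym (restore x c)) (trans (cong (ℤ._+ c) e) (restore y c))
  where
  restore : ∀ (x c : ℤ) → (x ℤ.- c) ℤ.+ c ≡ x
  restore = ℤSolver.solve-∀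

balance : ∀ a x b y t → a + x ≡ b + y → y ≡ x + t → a ≡ b + t
balance a x b .(x + t) t e refl = +-cancelʳ-≡ x a (b + t) (trans e (shuffle b x t))
  where
  shuffle : ∀ b x t → b + (x + t) ≡ b + t + x
  shuffle = solve-∀

balance⁻¹ : ∀ a x b y t → a + x ≡ b + y → a ≡ b + t → y ≡ x + t
balance⁻¹ .(b + t) x b y t e refl = +-cancelˡ-≡ b y (x + t) (trans (sym e) (shuffle b t x))
  where
  shuffle : ∀ b t x → b + t + x ≡ b + (x + t)
  shuffle = solve-∀

module Presentation (s k : ℕ) (s≥1 : 1 ≤ s) where

  -- positions in the R-part start after this threshold
  c : ℕ
  c = ⌈ s + k /2⌉

  Valid : Index → Set
  Valid (left , j , i) = j * k + 1 ≤ i × i ≤ ⌊ s /2⌋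
  Valid (right , j , i) = j * k + c + 1 ≤ i × i ≤ s

  valid? : ∀ x → Dec (Valid x)
  valid? (left , j , i) = (j * k + 1 ≤? i) ×-dec (i ≤? ⌊ s /2⌋)
  valid? (right , j , i) = (j * k + c + 1 ≤? i) ×-dec (i ≤? s)

  label : Index → ℕ
  label (_ , j , i) = 2 * i ∸ 1 + 2 * s * j

  -- label = 2 · rank - 1
  rank : Index → ℕ
  rank (_ , j , i) = i + s * j

  -- positions of the R-part are read from the right end
  mirror : ℕ → ℕ
  mirror i = s + 1 ∸ i

  point : Index → Pt
  point (left , j , i) = (+ (2 * i) ℤ.- + (k * j) , + j)
  point (right , j , i) = (+ (2 * mirror i + k * (j + 1)) , -[1+ j ])

  InP⇒label : ∀ {n} → InP s k n → ∃ λ x → Valid x × n ≡ label x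
  InP⇒label (inj₁ (j , i , lo , hi , e)) = (left , j , i) , (lo , hi) , e
  InP⇒label (inj₂ (j , i , lo , hi , e)) = (right , j , i) , (lo , hi) , e

  label∈P : ∀ x → Valid x → InP s k (label x)
  label∈P (left , j , i) (lo , hi) = inj₁ (j , i , lo , hi , refl)
  label∈P (right , j , i) (lo , hi) = inj₂ (j , i , lo , hi , refl)

  InP'⇒point : ∀ {p} → InP' s k p → ∃ λ x → Valid x × p ≡ point x
  InP'⇒point (inj₁ (j , i , lo , hi , e)) = (left , j , i) , (lo , hi) , e
  InP'⇒point (inj₂ (j , i , lo , hi , e)) = (right , j , i) , (lo , hi) , e

  point∈P' : ∀ x → Valid x → InP' s k (point x)
  point∈P' (left , j , i) (lo , hi) = inj₁ (j , i , lo , hi , refl)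
  point∈P' (right , j , i) (lo , hi) = inj₂ (j , i , lo , hi , refl)

  pos-lower : ∀ σ {j i} → Valid (σ , j , i) → j * k + 1 ≤ i
  pos-lower left (lo , _) = lo
  pos-lower right {j} (lo , _) = ≤-trans (+-monoˡ-≤ 1 (m≤m+n (j * k) c)) lo

  pos≥1 : ∀ σ {j i} → Valid (σ , j , i) → 1 ≤ i
  pos≥1 σ {j} v = ≤-trans (m≤n+m 1 (j * k)) (pos-lower σ v)

  pos≤s : ∀ σ {j i} → Valid (σ , j , i) → i ≤ s
  pos≤s left (_ , hi) = ≤-trans hi (⌊n/2⌋≤n s)
  pos≤s right (_ , hi) = hi

  pos>k : ∀ σ {j i} → Valid (σ , suc j , i) → k < i
  pos>k σ {j} {i} v = ≤-trans (s≤s (m≤m+n k (j * k))) (subst (_≤ i) (+-comm (suc j * k) 1) (pos-lower σ v))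

  ⌊s/2⌋≤c : ⌊ s /2⌋ ≤ c
  ⌊s/2⌋≤c = ≤-trans (⌊n/2⌋≤⌈n/2⌉ s) (⌈n/2⌉-mono (m≤m+n s k))

  left+k<right : ∀ {j i j' i'} → Valid (left , j , i) → Valid (right , suc j' , i') → i + k < i'
  left+k<right {j' = j'} {i'} (_ , hi) (lo , _) = begin-strict
    _ + k               ≤⟨ +-monoˡ-≤ k (≤-trans hi ⌊s/2⌋≤c) ⟩
    c + k               ≤⟨ m≤n+m (c + k) (j' * k) ⟩
    j' * k + (c + k)    <⟨ subst (_< suc j' * k + c + 1) (reorder (j' * k) c k) (m<m+n _ (s≤s z≤n)) ⟩
    suc j' * k + c + 1  ≤⟨ lo ⟩
    i'                  ∎
    where
    open ≤-Reasoning
    reorder : ∀ a c k → k + a + c ≡ a + (c + k)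
    reorder = solve-∀

  left<right : ∀ {j i j' i'} → Valid (left , j , i) → Valid (right , j' , i') → i < i'
  left<right {j' = j'} (_ , hi) (lo , _) =
    ≤-trans (s≤s (≤-trans hi ⌊s/2⌋≤c))
            (≤-trans (subst (_≤ j' * k + c + 1) (+-comm c 1) (+-monoˡ-≤ 1 (m≤n+m c (j' * k)))) lo)

  side-unique : ∀ σ σ' {j j' i} → Valid (σ , j , i) → Valid (σ' , j' , i) → σ ≡ σ'
  side-unique left left _ _ = refl
  side-unique right right _ _ = refl
  side-unique left right {j} {j'} {i} v w = ⊥-elim (<-irrefl refl (left<right {j} {i} {j'} {i} v w))
  side-unique right left {j} {j'} {i} v w = ⊥-elim (<-irrefl refl (left<right {j'} {i} {j} {i} w v))

  label-rank : ∀ x → Valid x → suc (label x) ≡ 2 * rank x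
  label-rank (σ , j , suc i) _ = unfold i s j
    where
    unfold : ∀ i s j → suc (i + suc (i + 0) + 2 * s * j) ≡ 2 * (suc i + s * j)
    unfold = solve-∀
  label-rank (σ , j , zero) v with pos≥1 σ v
  ... | ()

  -- Ranks of positions 1..s at level j fill the block (s·j, s·j + s].
  rank-below : ∀ {i j i' j'} → i ≤ s → 1 ≤ i' → j < j' → i + s * j < i' + s * j'
  rank-below {i} {j} {i'} {j'} i≤s 1≤i' j<j' = begin-strict
    i + s * j    ≤⟨ +-monoˡ-≤ (s * j) i≤s ⟩
    s + s * j    ≡⟨ *-suc s j ⟨
    s * suc j    ≤⟨ *-monoʳ-≤ s j<j' ⟩
    s * j'       <⟨ m<n+m (s * j') 1≤i' ⟩
    i' + s * j'  ∎
    where open ≤-Reasoning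

  rank-injective : ∀ {i j i' j'} → 1 ≤ i → i ≤ s → 1 ≤ i' → i' ≤ s →
    i + s * j ≡ i' + s * j' → j ≡ j' × i ≡ i'
  rank-injective {i} {j} {i'} {j'} 1≤i i≤s 1≤i' i'≤s e with <-cmp j j'
  ... | tri< j<j' _ _ = ⊥-elim (<-irrefl e (rank-below i≤s 1≤i' j<j'))
  ... | tri≈ _ refl _ = refl , +-cancelʳ-≡ (s * j) i i' e
  ... | tri> _ _ j>j' = ⊥-elim (<-irrefl (sym e) (rank-below i'≤s 1≤i j>j'))

  label-injective : ∀ {x y} → Valid x → Valid y → label x ≡ label y → x ≡ y
  label-injective {σ , j , i} {σ' , j' , i'} v w e
    with rank-injective (pos≥1 σ {j} v) (pos≤s σ {j} v) (pos≥1 σ' {j'} w) (pos≤s σ' {j'} w)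
           (*-cancelˡ-≡ _ _ 2 (trans (sym (label-rank _ v)) (trans (cong suc e) (label-rank _ w))))
  ... | refl , refl = cong (_, j , i) (side-unique σ σ' v w)

  point-injective : ∀ {x y} → Valid x → Valid y → point x ≡ point y → x ≡ y
  point-injective {left , j , i} {left , j' , i'} _ _ e with ℤP.+-injective (cong proj₂ e)
  ... | refl = cong (λ i → left , j , i)
    (*-cancelˡ-≡ _ _ 2 (ℤP.+-injective (ℤ-sub-cancelʳ (+ (k * j)) (cong proj₁ e))))
  point-injective {right , j , i} {right , j' , i'} v w e with ℤP.-[1+-injective (cong proj₂ e)
  ... | refl = cong (λ i → right , j , i)
    (∸-cancelˡ-≡ (≤-trans (pos≤s right {j} {i} v) (m≤m+n s 1)) (≤-trans (pos≤s right {j} {i'} w) (m≤m+n s 1))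
      (*-cancelˡ-≡ _ _ 2 (+-cancelʳ-≡ (k * (j + 1)) _ _ (ℤP.+-injective (cong proj₁ e)))))
  point-injective {left , _} {right , _} _ _ e with cong proj₂ e
  ... | ()
  point-injective {right , _} {left , _} _ _ e with cong proj₂ e
  ... | ()

  label-shift⇒rank-shift : ∀ x y t → Valid x → Valid y →
    label y ≡ label x + 2 * s + 2 * t → rank y ≡ rank x + s + t
  label-shift⇒rank-shift x y t v w e = *-cancelˡ-≡ _ _ 2 (begin
    2 * rank y                      ≡⟨ label-rank y w ⟨
    suc (label y)                   ≡⟨ cong suc e ⟩
    suc (label x) + 2 * s + 2 * t   ≡⟨ cong (λ z → z + 2 * s + 2 * t) (label-rank x v) ⟩
    2 * rank x + 2 * s + 2 * t      ≡⟨ factor (rank x) s t ⟩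
    2 * (rank x + s + t)            ∎)
    where
    open ≡-Reasoning
    factor : ∀ a s t → 2 * a + 2 * s + 2 * t ≡ 2 * (a + s + t)
    factor = solve-∀

  rank-shift⇒label-shift : ∀ x y t → Valid x → Valid y →
    rank y ≡ rank x + s + t → label y ≡ label x + 2 * s + 2 * t
  rank-shift⇒label-shift x y t v w e = suc-injective (begin
    suc (label y)                   ≡⟨ label-rank y w ⟩
    2 * rank y                      ≡⟨ cong (2 *_) e ⟩
    2 * (rank x + s + t)            ≡⟨ expand (rank x) s t ⟩
    2 * rank x + 2 * s + 2 * t      ≡⟨ cong (λ z → z + 2 * s + 2 * t) (label-rank x v) ⟨
    suc (label x) + 2 * s + 2 * t   ∎)
    where
    open ≡-Reasoning
    expand : ∀ a s t → 2 * (a + s + t) ≡ 2 * a + 2 * s + 2 * t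
    expand = solve-∀

  -- The index form of both cover relations: the same side, the next level,
  -- and a position shifted by at most k.
  Step : Index → Index → Set
  Step (σ , j , i) (σ' , j' , i') = σ ≡ σ' × j' ≡ suc j × Within k i i'

  -- A step between valid indices cannot change sides: L and R are more than k apart.
  step-side : ∀ σ σ' {j i i'} → Valid (σ , j , i) → Valid (σ' , suc j , i') → Within k i i' → σ ≡ σ'
  step-side left left _ _ _ = refl
  step-side right right _ _ _ = refl
  step-side left right {j} {i} v w (t , t≤k , refl) =
    ⊥-elim (<⇒≱ (left+k<right {j} {i} {j} v w) (+-monoʳ-≤ i t≤k))
  step-side right left {j} {i} v w (t , _ , refl) =
    ⊥-elim (<⇒≱ (left<right {suc j} {i + t} {j} {i} w v) (m≤m+n i t))

  shifted-rank : ∀ i j t → i + s * j + s + t ≡ (i + t) + s * suc j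
  shifted-rank i j t = trans (regroup s i j t) (cong (λ z → (i + t) + z) (sym (*-suc s j)))
    where
    regroup : ∀ s i j t → i + s * j + s + t ≡ (i + t) + (s + s * j)
    regroup = solve-∀

  rank-shift⇒step : ∀ x y t → Valid x → Valid y → t ≤ k → rank y ≡ rank x + s + t → Step x y
  rank-shift⇒step (σ , j , i) (σ' , j' , i') t v w t≤k e = compare (trans e (shifted-rank i j t))
    where
    open ≤-Reasoning
    lift : ∀ s t a → (s + t) + a ≡ t + (s + a)
    lift = solve-∀
    compare : i' + s * j' ≡ (i + t) + s * suc j → Step (σ , j , i) (σ' , j' , i')
    compare e' with <-cmp j' (suc j)
    ... | tri< j'<sj _ _ = ⊥-elim (<-irrefl e' (begin-strict
      i' + s * j'               <⟨ rank-below (pos≤s σ' {j'} w) (pos≥1 σ {j} v) j'<sj ⟩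
      i + s * suc j             ≤⟨ +-monoˡ-≤ (s * suc j) (m≤m+n i t) ⟩
      (i + t) + s * suc j       ∎))
    ... | tri> _ _ sj<j'@(s≤s {n = j''} _) = ⊥-elim (<-irrefl (sym e') (begin-strict
      (i + t) + s * suc j       ≤⟨ +-monoˡ-≤ (s * suc j) (+-monoˡ-≤ t (pos≤s σ {j} v)) ⟩
      (s + t) + s * suc j       ≡⟨ lift s t (s * suc j) ⟩
      t + (s + s * suc j)       ≡⟨ cong (λ z → t + z) (*-suc s (suc j)) ⟨
      t + s * suc (suc j)       <⟨ +-monoˡ-< (s * suc (suc j)) (≤-<-trans t≤k (pos>k σ' {j''} w)) ⟩
      i' + s * suc (suc j)      ≤⟨ +-monoʳ-≤ i' (*-monoʳ-≤ s sj<j') ⟩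
      i' + s * j'               ∎))
    ... | tri≈ _ refl _ = step-side σ σ' {j} v w within , refl , within
      where
      within : Within k i i'
      within = t , t≤k , +-cancelʳ-≡ (s * suc j) i' (i + t) e'

  step⇒rank-shift : ∀ x y → Step x y → ∃ λ t → t ≤ k × rank y ≡ rank x + s + t
  step⇒rank-shift (σ , j , i) (σ' , j' , i') (refl , refl , t , t≤k , refl) = t , t≤k , sym (shifted-rank i j t)

  coverP⇒step : ∀ x y → Valid x → Valid y → CoverP s k (label x) (label y) → Step x y
  coverP⇒step x y v w (_ , _ , t , t≤k , e) =
    rank-shift⇒step x y t v w t≤k (label-shift⇒rank-shift x y t v w e)

  step⇒coverP : ∀ x y → Valid x → Valid y → Step x y → CoverP s k (label x) (label y)
  step⇒coverP x y v w st with step⇒rank-shift x y st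
  ... | t , t≤k , e = label∈P x v , label∈P y w , t , t≤k , rank-shift⇒label-shift x y t v w e

  -- Horizontal distances between points on consecutive levels, in the form of close⇒within.
  left-gap : ∀ j i i' →
    (+ (2 * i') ℤ.- + (k * suc j)) ℤ.- (+ (2 * i) ℤ.- + (k * j)) ≡ 2 * i' ⊖ (2 * i + k)
  left-gap j i i' = begin
    (+ (2 * i') ℤ.- + (k * suc j)) ℤ.- (+ (2 * i) ℤ.- + (k * j))
      ≡⟨ cong (λ z → (+ (2 * i') ℤ.- + z) ℤ.- (+ (2 * i) ℤ.- + (k * j))) (*-suc k j) ⟩
    (+ (2 * i') ℤ.- (+ k ℤ.+ + (k * j))) ℤ.- (+ (2 * i) ℤ.- + (k * j))
      ≡⟨ cancel (+ (2 * i')) (+ (2 * i)) (+ (k * j)) (+ k) ⟩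
    + (2 * i') ℤ.- + (2 * i + k)
      ≡⟨ ℤP.[+m]-[+n]≡m⊖n (2 * i') (2 * i + k) ⟩
    2 * i' ⊖ (2 * i + k) ∎
    where
    open ≡-Reasoning
    cancel : ∀ (x y c d : ℤ) → (x ℤ.- (d ℤ.+ c)) ℤ.- (y ℤ.- c) ≡ x ℤ.- (y ℤ.+ d)
    cancel = ℤSolver.solve-∀

  right-gap : ∀ j u u' →
    ∣ + (2 * u' + k * (suc j + 1)) ℤ.- + (2 * u + k * (j + 1)) ∣ ≡ ∣ 2 * u ⊖ (2 * u' + k) ∣
  right-gap j u u' = begin
    ∣ + (2 * u' + k * (suc j + 1)) ℤ.- + (2 * u + k * (j + 1)) ∣
      ≡⟨ cong (λ z → ∣ + z ℤ.- + (2 * u + k * (j + 1)) ∣) (regroup (2 * u') k j) ⟩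
    ∣ + ((2 * u' + k) + k * (j + 1)) ℤ.- + (2 * u + k * (j + 1)) ∣
      ≡⟨ cong ∣_∣ (ℤP.[+m]-[+n]≡m⊖n (2 * u' + k + k * (j + 1)) (2 * u + k * (j + 1))) ⟩
    ∣ ((2 * u' + k) + k * (j + 1)) ⊖ (2 * u + k * (j + 1)) ∣
      ≡⟨ cong ∣_∣ (cong₂ _⊖_ (+-comm (2 * u' + k) (k * (j + 1))) (+-comm (2 * u) (k * (j + 1)))) ⟩
    ∣ (k * (j + 1) + (2 * u' + k)) ⊖ (k * (j + 1) + 2 * u) ∣
      ≡⟨ cong ∣_∣ (ℤP.+-cancelˡ-⊖ (k * (j + 1)) (2 * u' + k) (2 * u)) ⟩
    ∣ (2 * u' + k) ⊖ 2 * u ∣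
      ≡⟨ ℤP.∣m⊖n∣≡∣n⊖m∣ (2 * u' + k) (2 * u) ⟩
    ∣ 2 * u ⊖ (2 * u' + k) ∣ ∎
    where
    open ≡-Reasoning
    regroup : ∀ a k j → a + k * (suc j + 1) ≡ (a + k) + k * (j + 1)
    regroup = solve-∀

  mirror+pos : ∀ i → i ≤ s → mirror i + i ≡ s + 1
  mirror+pos i i≤s = m∸n+n≡m (≤-trans i≤s (m≤m+n s 1))

  within⇒mirror : ∀ {i i'} → i ≤ s → i' ≤ s → Within k i i' → Within k (mirror i') (mirror i)
  within⇒mirror {i} {i'} i≤s i'≤s (t , t≤k , e) =
    t , t≤k , balance (mirror i) i (mirror i') i' t (trans (mirror+pos i i≤s) (sym (mirror+pos i' i'≤s))) e

  mirror⇒within : ∀ {i i'} → i ≤ s → i' ≤ s → Within k (mirror i') (mirror i) → Within k i i'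
  mirror⇒within {i} {i'} i≤s i'≤s (t , t≤k , e) =
    t , t≤k , balance⁻¹ (mirror i) i (mirror i') i' t (trans (mirror+pos i i≤s) (sym (mirror+pos i' i'≤s))) e

  -- The second coordinate separates the L'-part (levels ≥ 0) from the R'-part (levels < 0).
  right∉L' : ∀ {j i} → ¬ InL' s k (point (right , j , i))
  right∉L' (_ , _ , _ , _ , e) with cong proj₂ e
  ... | ()

  left∉R' : ∀ {j i} → ¬ InR' s k (point (left , j , i))
  left∉R' (_ , _ , _ , _ , e) with cong proj₂ e
  ... | ()

  step⇒coverP' : ∀ x y → Valid x → Valid y → Step x y → CoverP' s k (point x) (point y)
  step⇒coverP' (left , j , i) (_ , _ , i') (lo , hi) (lo' , hi') (refl , refl , within) =
    inj₁ ( (suc j , i' , lo' , hi' , refl) , (j , i , lo , hi , refl)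
         , subst (_≤ k) (sym (cong ∣_∣ (left-gap j i i'))) (within⇒close i i' k within)
         , cong +_ (+-comm 1 j))
  step⇒coverP' (right , j , i) (_ , _ , i') (lo , hi) (lo' , hi') (refl , refl , within) =
    inj₂ ( (suc j , i' , lo' , hi' , refl) , (j , i , lo , hi , refl)
         , subst (_≤ k) (sym (right-gap j (mirror i) (mirror i')))
             (within⇒close (mirror i') (mirror i) k (within⇒mirror hi hi' within))
         , cong (λ z → -[1+ suc z ]) (sym (+-identityʳ j)))

  coverP'⇒step : ∀ x y → Valid x → Valid y → CoverP' s k (point x) (point y) → Step x y
  coverP'⇒step (left , j , i) (left , j' , i') _ _ (inj₁ (_ , _ , close , level))
    with trans (ℤP.+-injective level) (+-comm j 1)
  ... | refl = refl , refl , close⇒within i i' k (subst (_≤ k) (cong ∣_∣ (left-gap j i i')) close)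
  coverP'⇒step (right , j , i) (right , j' , i') (_ , hi) (_ , hi') (inj₂ (_ , _ , close , level))
    with trans (ℤP.-[1+-injective level) (cong suc (+-identityʳ j))
  ... | refl = refl , refl ,
    mirror⇒within hi hi' (close⇒within (mirror i') (mirror i) k (subst (_≤ k) (right-gap j (mirror i) (mirror i')) close))
  coverP'⇒step (left , j , i) _ _ _ (inj₂ (_ , xR , _)) = ⊥-elim (left∉R' {j} {i} xR)
  coverP'⇒step (right , j , i) _ _ _ (inj₁ (_ , xL , _)) = ⊥-elim (right∉L' {j} {i} xL)
  coverP'⇒step _ (left , j , i) _ _ (inj₂ (yR , _)) = ⊥-elim (left∉R' {j} {i} yR)
  coverP'⇒step _ (right , j , i) _ _ (inj₁ (yL , _)) = ⊥-elim (right∉L' {j} {i} yL)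

  leqP⇒leqP' : ∀ x y → Valid x → Valid y → LeqP s k (label x) (label y) → LeqP' s k (point x) (point y)
  leqP⇒leqP' x y v w le = starMap Valid label point label-injective
    (λ c → InP⇒label (proj₁ (proj₂ c)))
    (λ {x} {y} v w c → step⇒coverP' x y v w (coverP⇒step x y v w c))
    le v refl w refl

  leqP'⇒leqP : ∀ x y → Valid x → Valid y → LeqP' s k (point x) (point y) → LeqP s k (label x) (label y)
  leqP'⇒leqP x y v w le = starMap Valid point label point-injective upper∈P'
    (λ {x} {y} v w c → step⇒coverP x y v w (coverP'⇒step x y v w c))
    le v refl w refl
    where
    upper∈P' : ∀ {p q} → CoverP' s k p q → ∃ λ y → Valid y × q ≡ point y
    upper∈P' (inj₁ (qL , _)) = InP'⇒point (inj₁ qL)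
    upper∈P' (inj₂ (qR , _)) = InP'⇒point (inj₂ qR)

  label-sum⇒rank-sum : ∀ x y t → Valid x → Valid y →
    label x + label y ≡ 2 * s + 2 * t → rank x + rank y ≡ suc (s + t)
  label-sum⇒rank-sum x y t v w e = *-cancelˡ-≡ _ _ 2 (begin
    2 * (rank x + rank y)             ≡⟨ *-distribˡ-+ 2 (rank x) (rank y) ⟩
    2 * rank x + 2 * rank y           ≡⟨ cong₂ _+_ (label-rank x v) (label-rank y w) ⟨
    suc (label x) + suc (label y)     ≡⟨ cong suc (+-suc (label x) (label y)) ⟩
    2 + (label x + label y)           ≡⟨ cong (λ z → 2 + z) e ⟩
    2 + (2 * s + 2 * t)               ≡⟨ factor s t ⟩
    2 * suc (s + t)                   ∎)
    where
    open ≡-Reasoning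
    factor : ∀ s t → 2 + (2 * s + 2 * t) ≡ 2 * suc (s + t)
    factor = solve-∀

  rank-sum⇒label-sum : ∀ x y t → Valid x → Valid y →
    rank x + rank y ≡ suc (s + t) → label x + label y ≡ 2 * s + 2 * t
  rank-sum⇒label-sum x y t v w e = suc-injective (suc-injective (begin
    2 + (label x + label y)           ≡⟨ cong suc (+-suc (label x) (label y)) ⟨
    suc (label x) + suc (label y)     ≡⟨ cong₂ _+_ (label-rank x v) (label-rank y w) ⟩
    2 * rank x + 2 * rank y           ≡⟨ *-distribˡ-+ 2 (rank x) (rank y) ⟨
    2 * (rank x + rank y)             ≡⟨ cong (2 *_) e ⟩
    2 * suc (s + t)                   ≡⟨ expand s t ⟩
    2 + (2 * s + 2 * t)               ∎))
    where
    open ≡-Reasoning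
    expand : ∀ s t → 2 * suc (s + t) ≡ 2 + (2 * s + 2 * t)
    expand = solve-∀

  rank-sum⇒level₀ : ∀ σ σ' {j i j' i' t} → Valid (σ , j , i) → Valid (σ' , j' , i') → t ≤ k →
    (i + s * j) + (i' + s * j') ≡ suc (s + t) → j ≡ 0
  rank-sum⇒level₀ σ σ' {zero} _ _ _ _ = refl
  rank-sum⇒level₀ σ σ' {suc j} {i} {j'} {i'} {t} v w t≤k e = ⊥-elim (<-irrefl (sym e) (begin-strict
    suc (s + t)                   ≡⟨ +-suc s t ⟨
    s + suc t                     ≤⟨ +-monoʳ-≤ s (≤-<-trans t≤k (pos>k σ {j} v)) ⟩
    s + i                         ≤⟨ +-monoˡ-≤ i (m≤m+n s (s * j)) ⟩
    (s + s * j) + i               ≡⟨ trans (cong (_+ i) (sym (*-suc s j))) (+-comm (s * suc j) i) ⟩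
    i + s * suc j                 <⟨ m<m+n (i + s * suc j) (≤-trans (pos≥1 σ' {j'} w) (m≤m+n i' (s * j'))) ⟩
    (i + s * suc j) + (i' + s * j') ∎))
    where open ≤-Reasoning

  rank-level₀ : ∀ σ i → rank (σ , 0 , i) ≡ i
  rank-level₀ _ i = trans (cong (λ z → i + z) (*-zeroʳ s)) (+-identityʳ i)

  left-sum : ∀ {j i j' i'} → Valid (left , j , i) → Valid (left , j' , i') → i + i' ≤ s
  left-sum (_ , hi) (_ , hi') =
    ≤-trans (+-mono-≤ hi (≤-trans hi' (⌊n/2⌋≤⌈n/2⌉ s))) (≤-reflexive (⌊n/2⌋+⌈n/2⌉≡n s))

  right-sum : ∀ {j i j' i'} → Valid (right , j , i) → Valid (right , j' , i') → suc (s + k) < i + i'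
  right-sum {j} {i} {j'} {i'} (lo , _) (lo' , _) = begin-strict
    suc (s + k)           <⟨ s≤s (s≤s s+k≤c+c) ⟩
    suc (suc (c + c))     ≡⟨ cong suc (+-suc c c) ⟨
    suc c + suc c         ≤⟨ +-mono-≤ (c<pos j lo) (c<pos j' lo') ⟩
    i + i'                ∎
    where
    open ≤-Reasoning
    s+k≤c+c : s + k ≤ c + c
    s+k≤c+c = subst (_≤ c + c) (⌊n/2⌋+⌈n/2⌉≡n (s + k)) (+-monoˡ-≤ c (⌊n/2⌋≤⌈n/2⌉ (s + k)))
    c<pos : ∀ j {i} → j * k + c + 1 ≤ i → c < i
    c<pos j lo = ≤-trans (subst (_≤ j * k + c + 1) (+-comm c 1) (+-monoˡ-≤ 1 (m≤n+m c (j * k)))) lo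

  Clash : Index → Index → Set
  Clash x y = ∃ λ a → ∃ λ a' → point x ≡ (a , + 0) × point y ≡ (a' , -[1+ 0 ]) × ∣ a ℤ.- a' ∣ ≤ k

  level₀-gap : ∀ i u → (+ (2 * i) ℤ.- + (k * 0)) ℤ.- + (2 * u + k * (0 + 1)) ≡ 2 * i ⊖ (2 * u + k)
  level₀-gap i u = begin
    (+ (2 * i) ℤ.- + (k * 0)) ℤ.- + (2 * u + k * (0 + 1))
      ≡⟨ cong₂ (λ a b → (+ (2 * i) ℤ.- + a) ℤ.- + (2 * u + b)) (*-zeroʳ k) (*-identityʳ k) ⟩
    (+ (2 * i) ℤ.+ + 0) ℤ.- + (2 * u + k)
      ≡⟨ cong (λ z → z ℤ.- + (2 * u + k)) (ℤP.+-identityʳ (+ (2 * i))) ⟩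
    + (2 * i) ℤ.- + (2 * u + k)
      ≡⟨ ℤP.[+m]-[+n]≡m⊖n (2 * i) (2 * u + k) ⟩
    2 * i ⊖ (2 * u + k) ∎
    where open ≡-Reasoning

  mirror-shift-sum : ∀ i' t → i' ≤ s → (mirror i' + t) + i' ≡ suc (s + t)
  mirror-shift-sum i' t i'≤s = begin
    (mirror i' + t) + i'   ≡⟨ swap (mirror i') t i' ⟩
    (mirror i' + i') + t   ≡⟨ cong (_+ t) (mirror+pos i' i'≤s) ⟩
    s + 1 + t              ≡⟨ cong (_+ t) (+-comm s 1) ⟩
    suc (s + t)            ∎
    where
    open ≡-Reasoning
    swap : ∀ m t i → m + t + i ≡ m + i + t
    swap = solve-∀

  opposite-clash : ∀ {i i' t} → Valid (left , 0 , i) → Valid (right , 0 , i') → t ≤ k →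
    i + i' ≡ suc (s + t) → Clash (left , 0 , i) (right , 0 , i')
  opposite-clash {i} {i'} {t} _ (_ , i'≤s) t≤k e = _ , _ , refl , refl ,
    subst (_≤ k) (sym (cong ∣_∣ (level₀-gap i (mirror i'))))
      (within⇒close (mirror i') i k (t , t≤k , +-cancelʳ-≡ i' i (mirror i' + t) (trans e (sym (mirror-shift-sum i' t i'≤s)))))

  clash⇒forbidden : ∀ x y → Valid x → Valid y → Clash x y →
    ∃ λ t → t ≤ k × label x + label y ≡ 2 * s + 2 * t
  clash⇒forbidden (left , _ , i) (right , _ , i') v w (_ , _ , refl , refl , close)
    with close⇒within (mirror i') i k (subst (_≤ k) (cong ∣_∣ (level₀-gap i (mirror i'))) close)
  ... | t , t≤k , i≡ = t , t≤k , rank-sum⇒label-sum (left , 0 , i) (right , 0 , i') t v w rank-sum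
    where
    rank-sum : rank (left , 0 , i) + rank (right , 0 , i') ≡ suc (s + t)
    rank-sum = trans (cong₂ _+_ (rank-level₀ left i) (rank-level₀ right i'))
                     (trans (cong (_+ i') i≡) (mirror-shift-sum i' t (proj₂ w)))
  clash⇒forbidden (right , _) _ _ _ (_ , _ , () , _)
  clash⇒forbidden (left , _) (left , _) _ _ (_ , _ , _ , () , _)

  forbidden⇒clash : ∀ x y t → Valid x → Valid y → t ≤ k →
    label x + label y ≡ 2 * s + 2 * t → Clash x y ⊎ Clash y x
  forbidden⇒clash x@(σ , j , i) y@(σ' , j' , i') t v w t≤k e
    with label-sum⇒rank-sum x y t v w e
  ... | sum with rank-sum⇒level₀ σ σ' {j} {i} {j'} v w t≤k sum
               | rank-sum⇒level₀ σ' σ {j'} {i'} {j} w v t≤k (trans (+-comm (rank y) (rank x)) sum)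
  ... | refl | refl = level₀ σ σ' v w (trans (sym (cong₂ _+_ (rank-level₀ σ i) (rank-level₀ σ' i'))) sum)
    where
    level₀ : ∀ σ σ' → Valid (σ , 0 , i) → Valid (σ' , 0 , i') → i + i' ≡ suc (s + t) →
      Clash (σ , 0 , i) (σ' , 0 , i') ⊎ Clash (σ' , 0 , i') (σ , 0 , i)
    level₀ left right v w sum = inj₁ (opposite-clash v w t≤k sum)
    level₀ right left v w sum = inj₂ (opposite-clash w v t≤k (trans (+-comm i' i) sum))
    level₀ left left v w sum = ⊥-elim (<⇒≱ (s≤s (m≤m+n s t)) (subst (_≤ s) sum (left-sum {0} {i} {0} {i'} v w)))
    level₀ right right v w sum = ⊥-elim (<⇒≱ (subst (suc (s + k) <_) sum (right-sum {0} {i} {0} {i'} v w))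
                                              (s≤s (+-monoʳ-≤ s t≤k)))

  -- The level of an index is bounded by its label and by the second coordinate of its point,
  -- so membership in the transported subsets is decided by a finite search.
  level≤label : ∀ σ j i → j ≤ label (σ , j , i)
  level≤label σ j i = ≤-trans (subst (_≤ 2 * s * j) (*-identityˡ j) (*-monoˡ-≤ j 1≤2s)) (m≤n+m (2 * s * j) (2 * i ∸ 1))
    where
    1≤2s : 1 ≤ 2 * s
    1≤2s = ≤-trans s≥1 (m≤m+n s (s + 0))

  level≤height : ∀ σ j i → j ≤ ∣ proj₂ (point (σ , j , i)) ∣
  level≤height left j i = ≤-refl
  level≤height right j i = n≤1+n j

  push? : ∀ (I : ℕ → Bool) p → Dec (∃ λ x → Valid x × p ≡ point x × I (label x) ≡ true)
  push? I p = searchIndex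
    (λ x → valid? x ×-dec (×P.≡-dec ℤ._≟_ ℤ._≟_ p (point x) ×-dec (I (label x) Boolᴾ.≟ true)))
    ∣ proj₂ p ∣ s boxed
    where
    boxed : ∀ {σ j i} → Valid (σ , j , i) × p ≡ point (σ , j , i) × _ → j ≤ ∣ proj₂ p ∣ × i ≤ s
    boxed {σ} {j} {i} (v , e , _) = subst (λ q → j ≤ ∣ proj₂ q ∣) (sym e) (level≤height σ j i) , pos≤s σ {j} v

  pull? : ∀ (J : Pt → Bool) n → Dec (∃ λ x → Valid x × n ≡ label x × J (point x) ≡ true)
  pull? J n = searchIndex
    (λ x → valid? x ×-dec ((n ≟ label x) ×-dec (J (point x) Boolᴾ.≟ true)))
    n s boxed
    where
    boxed : ∀ {σ j i} → Valid (σ , j , i) × n ≡ label (σ , j , i) × _ → j ≤ n × i ≤ s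
    boxed {σ} {j} {i} (v , e , _) = subst (j ≤_) (sym e) (level≤label σ j i) , pos≤s σ {j} v

  open SubsetTransport Valid label point label-injective point-injective push? pull? public

  push-ideal : ∀ I → IsIdealP s k I → IsIdealP' s k (push I)
  push-ideal I (_ , down) = supported , closed
    where
    supported : ∀ p → push I p ≡ true → InP' s k p
    supported p e with push-sound I p e
    ... | x , v , refl , _ = point∈P' x v
    closed : ∀ p q → InP' s k p → LeqP' s k p q → push I q ≡ true → push I p ≡ true
    closed p q p∈P' le e with InP'⇒point p∈P' | push-sound I q e
    ... | x , v , refl | y , w , refl , Iy =
      push-complete I x v (down (label x) (label y) (label∈P x v) (leqP'⇒leqP x y v w le) Iy)

  pull-ideal : ∀ J → IsIdealP' s k J → IsIdealP s k (pull J)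
  pull-ideal J (_ , down) = supported , closed
    where
    supported : ∀ n → pull J n ≡ true → InP s k n
    supported n e with pull-sound J n e
    ... | x , v , refl , _ = label∈P x v
    closed : ∀ m n → InP s k m → LeqP s k m n → pull J n ≡ true → pull J m ≡ true
    closed m n m∈P le e with InP⇒label m∈P | pull-sound J n e
    ... | x , v , refl | y , w , refl , Jy =
      pull-complete J x v (down (point x) (point y) (point∈P' x v) (leqP⇒leqP' x y v w le) Jy)

  push-noclash : ∀ I → IsNice s k I → NoClash k (push I)
  push-noclash I nice a a' e e' close with push-sound I _ e | push-sound I _ e'
  ... | x , v , px , Ix | y , w , py , Iy with clash⇒forbidden x y v w (a , a' , sym px , sym py , close)
  ... | t , t≤k , sum = nice (label x) (label y) Ix Iy t t≤k sum

  pull-nice : ∀ J → NoClash k J → IsNice s k (pull J)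
  pull-nice J noclash h₁ h₂ e₁ e₂ t t≤k sum with pull-sound J h₁ e₁ | pull-sound J h₂ e₂
  ... | x , v , refl , Jx | y , w , refl , Jy with forbidden⇒clash x y t v w t≤k sum
  ... | inj₁ (a , a' , px , py , close) = noclash a a' (subst (λ p → J p ≡ true) px Jx) (subst (λ p → J p ≡ true) py Jy) close
  ... | inj₂ (a , a' , py , px , close) = noclash a a' (subst (λ p → J p ≡ true) py Jy) (subst (λ p → J p ≡ true) px Jx) close

-- Theorem 2.8.
theorem2p8 : (s k : ℕ) → 1 ≤ s → 1 ≤ k →
    Bijection (NiceIdealSetoid s k) (GoodIdealSetoid' s k)
theorem2p8 s k s≥1 _ =
  bijection
    (λ I → IsIdealP s k I × IsNice s k I) (λ J → IsIdealP' s k J × NoClash k J)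
    (λ good n In → InP⇒label (proj₁ (proj₁ good) n In))
    (λ good p Jp → InP'⇒point (proj₁ (proj₁ good) p Jp))
    (λ I (ideal , nice) → push-ideal I ideal , push-noclash I nice)
    (λ J (ideal , noclash) → pull-ideal J ideal , pull-nice J noclash)
  where open Presentation s k s≥1
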